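{- Let $S$ be a finite Kleene relation algebra satisfying the Tarski rule, let $p \in S$ be a forest and let $x \in S$ be a point. Consider the program (with program variable $y$ ranging over $S$) $y := x$; while $y \neq p^T\cdot y$ do $y := p^T \cdot y$ od. Then this program terminates, and in its final state $y$ is a point and $y = ((p^T)^*\cdot x) \sqcap ((p\sqcap 1)\cdot\top)$.
   Context: A Kleene relation algebra is a structure $(S,\sqcup,\sqcap,\cdot,\overline{\phantom{x}},{}^T,{}^*,\bot,\top,1)$ such that $(S,\sqcup,\sqcap,\overline{\phantom{x}},\bot,\top)$ is a Boolean algebra with order $x \sqsubseteq y \iff x \sqcup y = y$; $(S,\sqcup,\cdot,\bot,1)$ is an idempotent semiring ($\cdot$ associative with two-sided unit $1$, distributing over $\sqcup$, $\bot$ a two-sided zero of $\cdot$); transposition satisfies $(x\sqcup y)^T = x^T \sqcup y^T$, $(x^T)^T = x$, $(x\cdot y)^T = y^T\cdot x^T$ and $(x\cdot y)\sqcap z \sqsubseteq x\cdot(y\sqcap(x^T\cdot z))$; and the star satisfies $1\sqcup y\cdot y^* = y^* = 1 \sqcup y^*\cdot y$, $z\sqcup y\cdot x\sqsubseteq x \Rightarrow y^*\cdot z\sqsubseteq x$, $z \sqcup x\cdot y \sqsubseteq x \Rightarrow z\cdot y^*\sqsubseteq x$. The Tarski rule states $\top\cdot x\cdot\top = \top$ for every $x \neq \bot$. Write $x^+ = x\cdot x^*$. An element $x$ is univalent if $x^T x\sqsubseteq 1$, total if $1\sqsubseteq x x^T$, a mapping if univalent and total, injective if $x x^T\sqsubseteq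 1$, surjective if $1\sqsubseteq x^T x$, a vector if $x\cdot\top = x$, a point if it is an injective surjective vector, acyclic if $x^+\sqsubseteq\overline 1$, and a forest if it is a mapping and $x\sqcap\overline{1}$ is acyclic. Programs are sequential while-programs with the usual semantics: assignments evaluate their right-hand side in the current state; $p^T\cdot y$ is the value of the parent array $p$ at node $y$. -}

module Defs where

open import Level using (Level)
import Level as L
open import Data.Nat using (ℕ)
open import Data.Fin using (Fin)
open import Data.Product using (Σ; _×_)
open import Function.Bundles using (_↔_)
open import Relation.Binary.PropositionalEquality using (_≡_)
open import Relation.Nullary using (¬_)
open import Algebra.Lattice.Structures using (IsBooleanAlgebra)
open import Algebra.Structures using (IsIdempotentSemiring)

record KleeneRelationAlgebra (c : Level) : Set (L.suc c) where
  infixr 6 _⊔_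
  infixr 7 _⊓_
  infixr 8 _·_
  infix 9 _ᵀ _*
  infix 4 _⊑_
  field
    S    : Set c
    _⊔_  : S → S → S
    _⊓_  : S → S → S
    _·_  : S → S → S
    ‾    : S → S
    _ᵀ   : S → S
    _*   : S → S
    ⊥    : S
    ⊤    : S
    𝟏    : S

  _⊑_ : S → S → Set c
  x ⊑ y = x ⊔ y ≡ y

  field
    isBooleanAlgebra     : IsBooleanAlgebra _≡_ _⊔_ _⊓_ ‾ ⊤ ⊥
    isIdempotentSemiring : IsIdempotentSemiring _≡_ _⊔_ _·_ ⊥ 𝟏
    ᵀ-⊔       : ∀ x y → (x ⊔ y) ᵀ ≡ x ᵀ ⊔ y ᵀ
    ᵀ-invol   : ∀ x → (x ᵀ) ᵀ ≡ x
    ᵀ-·       : ∀ x y → (x · y) ᵀ ≡ y ᵀ · x ᵀ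
    dedekind  : ∀ x y z → (x · y) ⊓ z ⊑ x · (y ⊓ (x ᵀ · z))
    star-unfoldˡ : ∀ y → 𝟏 ⊔ y · (y *) ≡ y *
    star-unfoldʳ : ∀ y → 𝟏 ⊔ (y *) · y ≡ y *
    star-inductˡ : ∀ x y z → z ⊔ y · x ⊑ x → (y *) · z ⊑ x
    star-inductʳ : ∀ x y z → z ⊔ x · y ⊑ x → z · (y *) ⊑ x

module KRA {c : Level} (K : KleeneRelationAlgebra c) where
  open KleeneRelationAlgebra K

  _⁺ : S → S
  x ⁺ = x · (x *)

  univalent : S → Set c
  univalent x = x ᵀ · x ⊑ 𝟏

  total : S → Set c
  total x = 𝟏 ⊑ x · x ᵀ

  mapping : S → Set c
  mapping x = univalent x × total x

  injective : S → Set c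
  injective x = x · x ᵀ ⊑ 𝟏

  surjective : S → Set c
  surjective x = 𝟏 ⊑ x ᵀ · x

  vector : S → Set c
  vector x = x · ⊤ ≡ x

  point : S → Set c
  point x = (injective x × surjective x) × vector x

  acyclic : S → Set c
  acyclic x = x ⁺ ⊑ ‾ 𝟏

  forest : S → Set c
  forest x = mapping x × acyclic (x ⊓ ‾ 𝟏)

  Tarski : Set c
  Tarski = ∀ x → ¬ (x ≡ ⊥) → ⊤ · x · ⊤ ≡ ⊤

  -- Big-step semantics of the loop
  --   while y ≠ pᵀ·y do y := pᵀ·y od
  -- LoopExec p y y' : started in state y, the loop terminates in final state y'.
  data LoopExec (p : S) : S → S → Set c where
    stop : ∀ {y} → y ≡ p ᵀ · y → LoopExec p y y
    step : ∀ {y y'} → ¬ (y ≡ p ᵀ · y) → LoopExec p (p ᵀ · y) y' → LoopExec p y y'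

Finite : ∀ {c} → KleeneRelationAlgebra c → Set c
Finite K = Σ ℕ (λ n → KleeneRelationAlgebra.S K ↔ Fin n)

-- Every iterate (pᵀ)ⁱ·x is again a point.  By the Tarski rule a point is an atom among
-- the vectors, so a point y is either a fixed point of pᵀ·_, and then lies below the
-- roots (p ⊓ 𝟏)·⊤, or it is disjoint from the roots and pᵀ·y = (p ⊓ ‾𝟏)ᵀ·y.  In a finite
-- algebra the iterates repeat; until a fixed point is reached the walk only uses
-- (p ⊓ ‾𝟏)ᵀ, so a repetition would put a point on a cycle of p ⊓ ‾𝟏, which acyclicity
-- forbids.  Hence the loop stops at a fixed point.  Along the loop
-- ((pᵀ)*·y) ⊓ ((p ⊓ 𝟏)·⊤) is invariant, because (pᵀ)*·y = y ⊔ (pᵀ)*·(pᵀ·y) and a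
-- non-fixed y meets no root; at the fixed point it equals y.
module Submission where

open import Defs
open import Level using (Level)
open import Data.Nat using (ℕ; zero; suc; _+_; _<_)
open import Data.Nat.Properties using (n<1+n; +-comm; m≤n⇒∃[o]m+o≡n)
open import Data.Nat.GeneralisedArithmetic using (fold; fold-+)
open import Data.Fin using (Fin; toℕ)
open import Data.Fin.Properties using (pigeonhole; inj⇒≟)
open import Data.Product using (Σ; ∃; ∃₂; _×_; _,_; proj₁; proj₂; map₂)
open import Data.Sum using (_⊎_; inj₁; inj₂)
open import Data.Empty using (⊥-elim)
open import Function.Bundles using (_↔_; Injection)
open import Function.Properties.Inverse using (↔⇒↣)
open import Relation.Nullary using (¬_; yes; no)
open import Relation.Binary.Bundles using (Poset)
open import Relation.Binary.Definitions using (DecidableEquality)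
open import Relation.Binary.PropositionalEquality
open import Algebra.Lattice.Bundles using (BooleanAlgebra)
open import Algebra.Structures using (IsIdempotentSemiring)
import Algebra.Lattice.Properties.BooleanAlgebra as BooleanAlgebraProperties
import Relation.Binary.Reasoning.PartialOrder as PosetReasoning

sequence-repeats : ∀ {a} {A : Set a} {n} → A ↔ Fin n → (f : ℕ → A) →
                   ∃₂ λ i j → i < j × f i ≡ f j
sequence-repeats {n = n} A↔Fin f =
  let i , j , i<j , fi≡fj = pigeonhole (n<1+n n) (λ k → to (f (toℕ k)))
  in  toℕ i , toℕ j , i<j , injective fi≡fj
  where open Injection (↔⇒↣ A↔Fin)

module Properties {c : Level} (K : KleeneRelationAlgebra c) where
  open KleeneRelationAlgebra K
  open KRA K
  open IsIdempotentSemiring isIdempotentSemiring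
    renaming (*-assoc to ·-assoc; *-identityˡ to ·-identityˡ; *-identityʳ to ·-identityʳ;
              +-identityˡ to ⊔-identityˡ; +-identityʳ to ⊔-identityʳ)
    using (distribˡ; distribʳ; zeroˡ; zeroʳ)

  booleanAlgebra : BooleanAlgebra c c
  booleanAlgebra = record { isBooleanAlgebra = isBooleanAlgebra }

  open BooleanAlgebra booleanAlgebra
    using (∨-comm; ∨-assoc; ∧-comm; ∧-assoc; ∨-absorbs-∧; ∧-absorbs-∨;
           ∧-distribˡ-∨; ∧-distribʳ-∨; ∨-complementʳ; ∧-complementˡ)
  open BooleanAlgebraProperties booleanAlgebra using (∧-identityˡ; ∧-identityʳ; ∧-idem; ∨-idem)

  ⊑-reflexive : ∀ {x y} → x ≡ y → x ⊑ y
  ⊑-reflexive {x} refl = ∨-idem x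

  ⊑-trans : ∀ {x y z} → x ⊑ y → y ⊑ z → x ⊑ z
  ⊑-trans {x} {y} {z} x⊑y y⊑z = begin
    x ⊔ z       ≡⟨ cong (x ⊔_) y⊑z ⟨
    x ⊔ (y ⊔ z) ≡⟨ ∨-assoc x y z ⟨
    (x ⊔ y) ⊔ z ≡⟨ cong (_⊔ z) x⊑y ⟩
    y ⊔ z       ≡⟨ y⊑z ⟩
    z           ∎
    where open ≡-Reasoning

  ⊑-antisym : ∀ {x y} → x ⊑ y → y ⊑ x → x ≡ y
  ⊑-antisym {x} {y} x⊑y y⊑x = trans (sym y⊑x) (trans (∨-comm y x) x⊑y)

  ⊑-poset : Poset c c c
  ⊑-poset = record
    { _≈_            = _≡_
    ; _≤_            = _⊑_
    ; isPartialOrder = record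
      { isPreorder = record
        { isEquivalence = isEquivalence
        ; reflexive     = ⊑-reflexive
        ; trans         = ⊑-trans
        }
      ; antisym    = ⊑-antisym
      }
    }

  module ⊑-Reasoning = PosetReasoning ⊑-poset

  x⊑x⊔y : ∀ {x y} → x ⊑ x ⊔ y
  x⊑x⊔y {x} {y} = trans (sym (∨-assoc x x y)) (cong (_⊔ y) (∨-idem x))

  y⊑x⊔y : ∀ {x y} → y ⊑ x ⊔ y
  y⊑x⊔y {x} {y} = subst (y ⊑_) (∨-comm y x) x⊑x⊔y

  ⊑⇒⊓≡ : ∀ {x y} → x ⊑ y → x ⊓ y ≡ x
  ⊑⇒⊓≡ {x} {y} x⊑y = trans (cong (x ⊓_) (sym x⊑y)) (∧-absorbs-∨ x y)

  ⊓≡⇒⊑ : ∀ {x y} → x ⊓ y ≡ x → x ⊑ y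
  ⊓≡⇒⊑ {x} {y} x⊓y≡x = begin
    x ⊔ y       ≡⟨ cong (_⊔ y) x⊓y≡x ⟨
    x ⊓ y ⊔ y   ≡⟨ ∨-comm (x ⊓ y) y ⟩
    y ⊔ x ⊓ y   ≡⟨ cong (y ⊔_) (∧-comm x y) ⟩
    y ⊔ y ⊓ x   ≡⟨ ∨-absorbs-∧ y x ⟩
    y           ∎
    where open ≡-Reasoning

  x⊓y⊑x : ∀ {x y} → x ⊓ y ⊑ x
  x⊓y⊑x {x} {y} = ⊓≡⇒⊑ (trans (∧-comm (x ⊓ y) x) (trans (sym (∧-assoc x x y)) (cong (_⊓ y) (∧-idem x))))

  x⊓y⊑y : ∀ {x y} → x ⊓ y ⊑ y
  x⊓y⊑y {x} {y} = subst (_⊑ y) (∧-comm y x) x⊓y⊑x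

  ⊓-greatest : ∀ {x y z} → z ⊑ x → z ⊑ y → z ⊑ x ⊓ y
  ⊓-greatest {x} {y} {z} z⊑x z⊑y =
    ⊓≡⇒⊑ (trans (sym (∧-assoc z x y)) (trans (cong (_⊓ y) (⊑⇒⊓≡ z⊑x)) (⊑⇒⊓≡ z⊑y)))

  ⊑⊥⇒≡⊥ : ∀ {x} → x ⊑ ⊥ → x ≡ ⊥
  ⊑⊥⇒≡⊥ {x} x⊑⊥ = trans (sym (⊔-identityʳ x)) x⊑⊥

  ⊤-greatest : ∀ {x} → x ⊑ ⊤
  ⊤-greatest {x} = ⊓≡⇒⊑ (∧-identityʳ x)

  ·-monoʳ : ∀ {x y z} → x ⊑ y → z · x ⊑ z · y
  ·-monoʳ {x} {y} {z} x⊑y = trans (sym (distribˡ z x y)) (cong (z ·_) x⊑y)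

  ·-monoˡ : ∀ {x y z} → x ⊑ y → x · z ⊑ y · z
  ·-monoˡ {x} {y} {z} x⊑y = trans (sym (distribʳ z x y)) (cong (_· z) x⊑y)

  ·-middle : ∀ a b c d → (a · b) · (c · d) ≡ a · ((b · c) · d)
  ·-middle a b c d = trans (·-assoc a b (c · d)) (cong (a ·_) (sym (·-assoc b c d)))

  ᵀ-mono : ∀ {x y} → x ⊑ y → x ᵀ ⊑ y ᵀ
  ᵀ-mono {x} {y} x⊑y = trans (sym (ᵀ-⊔ x y)) (cong _ᵀ x⊑y)

  ᵀ-reflects-⊑ : ∀ {x y} → x ᵀ ⊑ y ᵀ → x ⊑ y
  ᵀ-reflects-⊑ {x} {y} xᵀ⊑yᵀ = subst₂ _⊑_ (ᵀ-invol x) (ᵀ-invol y) (ᵀ-mono xᵀ⊑yᵀ)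

  ᵀ-adjoint : ∀ {x y} → x ⊑ y ᵀ → x ᵀ ⊑ y
  ᵀ-adjoint {x} {y} x⊑yᵀ = subst (x ᵀ ⊑_) (ᵀ-invol y) (ᵀ-mono x⊑yᵀ)

  ᵀ-⊓ : ∀ x y → (x ⊓ y) ᵀ ≡ x ᵀ ⊓ y ᵀ
  ᵀ-⊓ x y = ⊑-antisym
    (⊓-greatest (ᵀ-mono x⊓y⊑x) (ᵀ-mono x⊓y⊑y))
    (subst (_⊑ (x ⊓ y) ᵀ) (ᵀ-invol (x ᵀ ⊓ y ᵀ))
      (ᵀ-mono (⊓-greatest (ᵀ-adjoint x⊓y⊑x) (ᵀ-adjoint x⊓y⊑y))))

  ᵀ-ᵀ· : ∀ x y → (x ᵀ · y) ᵀ ≡ y ᵀ · x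
  ᵀ-ᵀ· x y = trans (ᵀ-· (x ᵀ) y) (cong (y ᵀ ·_) (ᵀ-invol x))

  ᵀ-⊥ : ⊥ ᵀ ≡ ⊥
  ᵀ-⊥ = ⊑⊥⇒≡⊥ (ᵀ-adjoint (⊔-identityˡ (⊥ ᵀ)))

  ᵀ-𝟏 : 𝟏 ᵀ ≡ 𝟏
  ᵀ-𝟏 = begin
    𝟏 ᵀ          ≡⟨ ·-identityʳ (𝟏 ᵀ) ⟨
    𝟏 ᵀ · 𝟏      ≡⟨ ᵀ-ᵀ· 𝟏 𝟏 ⟨
    (𝟏 ᵀ · 𝟏) ᵀ  ≡⟨ cong _ᵀ (·-identityʳ (𝟏 ᵀ)) ⟩
    (𝟏 ᵀ) ᵀ      ≡⟨ ᵀ-invol 𝟏 ⟩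
    𝟏            ∎
    where open ≡-Reasoning

  dedekindʳ : ∀ x y z → (x · y) ⊓ z ⊑ (x ⊓ z · y ᵀ) · y
  dedekindʳ x y z = ᵀ-reflects-⊑ (subst₂ _⊑_ lhs rhs (dedekind (y ᵀ) (x ᵀ) (z ᵀ)))
    where
    lhs : (y ᵀ · x ᵀ) ⊓ z ᵀ ≡ ((x · y) ⊓ z) ᵀ
    lhs = sym (trans (ᵀ-⊓ (x · y) z) (cong (_⊓ z ᵀ) (ᵀ-· x y)))
    rhs : y ᵀ · (x ᵀ ⊓ (y ᵀ) ᵀ · z ᵀ) ≡ ((x ⊓ z · y ᵀ) · y) ᵀ
    rhs = sym (trans (ᵀ-· (x ⊓ z · y ᵀ) y)
                     (cong (y ᵀ ·_) (trans (ᵀ-⊓ x (z · y ᵀ)) (cong (x ᵀ ⊓_) (ᵀ-· z (y ᵀ))))))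

  subidentity⇒⊑ᵀ : ∀ {x} → x ⊑ 𝟏 → x ⊑ x ᵀ
  subidentity⇒⊑ᵀ {x} x⊑𝟏 = begin
    x                  ≡⟨ trans (cong (_⊓ 𝟏) (·-identityʳ x)) (⊑⇒⊓≡ x⊑𝟏) ⟨
    (x · 𝟏) ⊓ 𝟏        ≤⟨ dedekind x 𝟏 𝟏 ⟩
    x · (𝟏 ⊓ x ᵀ · 𝟏)  ≤⟨ ·-monoʳ x⊓y⊑y ⟩
    x · x ᵀ · 𝟏        ≤⟨ ·-monoˡ x⊑𝟏 ⟩
    𝟏 · x ᵀ · 𝟏        ≡⟨ trans (·-identityˡ _) (·-identityʳ (x ᵀ)) ⟩
    x ᵀ                ∎
    where open ⊑-Reasoning

  subidentity-ᵀ : ∀ {x} → x ⊑ 𝟏 → x ᵀ ≡ x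
  subidentity-ᵀ {x} x⊑𝟏 = ⊑-antisym (ᵀ-adjoint (subidentity⇒⊑ᵀ x⊑𝟏)) (subidentity⇒⊑ᵀ x⊑𝟏)

  𝟏⊑* : ∀ {x} → 𝟏 ⊑ x *
  𝟏⊑* {x} = subst (𝟏 ⊑_) (star-unfoldʳ x) x⊑x⊔y

  x·x*⊑x* : ∀ {x} → x · x * ⊑ x *
  x·x*⊑x* {x} = subst (x · x * ⊑_) (star-unfoldˡ x) y⊑x⊔y

  *-unfold-· : ∀ x z → x * · z ≡ z ⊔ x * · (x · z)
  *-unfold-· x z = begin
    x * · z                 ≡⟨ cong (_· z) (star-unfoldʳ x) ⟨
    (𝟏 ⊔ x * · x) · z       ≡⟨ distribʳ z 𝟏 (x * · x) ⟩
    𝟏 · z ⊔ (x * · x) · z   ≡⟨ cong₂ _⊔_ (·-identityˡ z) (·-assoc (x *) x z) ⟩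
    z ⊔ x * · (x · z)       ∎
    where open ≡-Reasoning

  *-fixpoint : ∀ {x z} → z ≡ x · z → x * · z ≡ z
  *-fixpoint {x} {z} z≡x·z = ⊑-antisym
    (star-inductˡ z x z (trans (cong (λ t → (z ⊔ t) ⊔ z) (sym z≡x·z))
                               (trans (cong (_⊔ z) (∨-idem z)) (∨-idem z))))
    (subst (_⊑ x * · z) (·-identityˡ z) (·-monoˡ 𝟏⊑*))

  pow : S → ℕ → S
  pow x zero    = 𝟏
  pow x (suc m) = x · pow x m

  pow-comm : ∀ x m → pow x m · x ≡ x · pow x m
  pow-comm x zero    = trans (·-identityˡ x) (sym (·-identityʳ x))
  pow-comm x (suc m) = trans (·-assoc x (pow x m) x) (cong (x ·_) (pow-comm x m))

  pow-ᵀ : ∀ x m → pow (x ᵀ) m ≡ pow x m ᵀ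
  pow-ᵀ x zero    = sym ᵀ-𝟏
  pow-ᵀ x (suc m) = begin
    x ᵀ · pow (x ᵀ) m   ≡⟨ cong (x ᵀ ·_) (pow-ᵀ x m) ⟩
    x ᵀ · pow x m ᵀ     ≡⟨ ᵀ-· (pow x m) x ⟨
    (pow x m · x) ᵀ     ≡⟨ cong _ᵀ (pow-comm x m) ⟩
    (x · pow x m) ᵀ     ∎
    where open ≡-Reasoning

  pow⊑* : ∀ x m → pow x m ⊑ x *
  pow⊑* x zero    = 𝟏⊑*
  pow⊑* x (suc m) = ⊑-trans (·-monoʳ (pow⊑* x m)) x·x*⊑x*

  irreflexive : S → Set c
  irreflexive x = x ⊓ 𝟏 ≡ ⊥

  irreflexive-ᵀ : ∀ {x} → irreflexive x → irreflexive (x ᵀ)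
  irreflexive-ᵀ {x} x⊓𝟏≡⊥ = begin
    x ᵀ ⊓ 𝟏      ≡⟨ cong (x ᵀ ⊓_) ᵀ-𝟏 ⟨
    x ᵀ ⊓ 𝟏 ᵀ    ≡⟨ ᵀ-⊓ x 𝟏 ⟨
    (x ⊓ 𝟏) ᵀ    ≡⟨ cong _ᵀ x⊓𝟏≡⊥ ⟩
    ⊥ ᵀ          ≡⟨ ᵀ-⊥ ⟩
    ⊥            ∎
    where open ≡-Reasoning

  acyclic⇒irreflexive-pow : ∀ {x} → acyclic x → ∀ m → irreflexive (pow x (suc m))
  acyclic⇒irreflexive-pow {x} x⁺⊑‾𝟏 m = ⊑⊥⇒≡⊥ (begin
    pow x (suc m) ⊓ 𝟏   ≤⟨ ⊓-greatest (⊑-trans x⊓y⊑x (⊑-trans (·-monoʳ (pow⊑* x m)) x⁺⊑‾𝟏)) x⊓y⊑y ⟩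
    ‾ 𝟏 ⊓ 𝟏             ≡⟨ ∧-complementˡ 𝟏 ⟩
    ⊥                   ∎)
    where open ⊑-Reasoning

  injective-meet : ∀ {z} x → injective z → (x · z) ⊓ z ⊑ (x ⊓ 𝟏) · z
  injective-meet {z} x z·zᵀ⊑𝟏 = ⊑-trans (dedekindʳ x z z)
    (·-monoˡ (⊓-greatest x⊓y⊑x (⊑-trans x⊓y⊑y z·zᵀ⊑𝟏)))

  injective-⊑-irreflexive·⇒≡⊥ : ∀ {w x} → injective w → irreflexive x → w ⊑ x · w → w ≡ ⊥
  injective-⊑-irreflexive·⇒≡⊥ {w} {x} inj-w x⊓𝟏≡⊥ w⊑x·w = ⊑⊥⇒≡⊥ (begin
    w                ≡⟨ trans (∧-comm (x · w) w) (⊑⇒⊓≡ w⊑x·w) ⟨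
    (x · w) ⊓ w      ≤⟨ injective-meet x inj-w ⟩
    (x ⊓ 𝟏) · w      ≡⟨ cong (_· w) x⊓𝟏≡⊥ ⟩
    ⊥ · w            ≡⟨ zeroˡ w ⟩
    ⊥                ∎)
    where open ⊑-Reasoning

  mapping-ᵀ·-point : ∀ {p w} → mapping p → point w → point (p ᵀ · w)
  mapping-ᵀ·-point {p} {w} (pᵀ·p⊑𝟏 , 𝟏⊑p·pᵀ) ((w·wᵀ⊑𝟏 , 𝟏⊑wᵀ·w) , w·⊤≡w) =
    (injective-ᵀ· , surjective-ᵀ·) , trans (·-assoc (p ᵀ) w ⊤) (cong (p ᵀ ·_) w·⊤≡w)
    where
    open ⊑-Reasoning
    injective-ᵀ· : injective (p ᵀ · w)
    injective-ᵀ· = begin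
      (p ᵀ · w) · (p ᵀ · w) ᵀ  ≡⟨ cong ((p ᵀ · w) ·_) (ᵀ-ᵀ· p w) ⟩
      (p ᵀ · w) · (w ᵀ · p)    ≡⟨ ·-middle (p ᵀ) w (w ᵀ) p ⟩
      p ᵀ · (w · w ᵀ) · p      ≤⟨ ·-monoʳ (·-monoˡ w·wᵀ⊑𝟏) ⟩
      p ᵀ · 𝟏 · p              ≡⟨ cong (p ᵀ ·_) (·-identityˡ p) ⟩
      p ᵀ · p                  ≤⟨ pᵀ·p⊑𝟏 ⟩
      𝟏                        ∎
    surjective-ᵀ· : surjective (p ᵀ · w)
    surjective-ᵀ· = begin
      𝟏                        ≤⟨ 𝟏⊑wᵀ·w ⟩
      w ᵀ · w                  ≡⟨ cong (w ᵀ ·_) (·-identityˡ w) ⟨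
      w ᵀ · 𝟏 · w              ≤⟨ ·-monoʳ (·-monoˡ 𝟏⊑p·pᵀ) ⟩
      w ᵀ · (p · p ᵀ) · w      ≡⟨ ·-middle (w ᵀ) p (p ᵀ) w ⟨
      (w ᵀ · p) · (p ᵀ · w)    ≡⟨ cong (_· (p ᵀ · w)) (ᵀ-ᵀ· p w) ⟨
      (p ᵀ · w) ᵀ · (p ᵀ · w)  ∎

  surjective-⊥⇒trivial : surjective ⊥ → ∀ w → w ≡ ⊥
  surjective-⊥⇒trivial 𝟏⊑⊥ᵀ·⊥ w = begin
    w      ≡⟨ ·-identityʳ w ⟨
    w · 𝟏  ≡⟨ cong (w ·_) (⊑⊥⇒≡⊥ (⊑-trans 𝟏⊑⊥ᵀ·⊥ (⊑-reflexive (zeroʳ (⊥ ᵀ))))) ⟩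
    w · ⊥  ≡⟨ zeroʳ w ⟩
    ⊥      ∎
    where open ≡-Reasoning

  module Atoms (_≟_ : DecidableEquality S) (tarski : Tarski) where

    vector-⊑-point : ∀ {v z} → vector v → v ⊑ z → point z → v ≡ ⊥ ⊎ v ≡ z
    vector-⊑-point {v} {z} v·⊤≡v v⊑z ((z·zᵀ⊑𝟏 , _) , _) with v ≟ ⊥
    ... | yes v≡⊥ = inj₁ v≡⊥
    ... | no  v≢⊥ = inj₂ (⊑-antisym v⊑z z⊑v)
      where
      open ⊑-Reasoning
      ⊤·v≡⊤ : ⊤ · v ≡ ⊤
      ⊤·v≡⊤ = trans (cong (⊤ ·_) (sym v·⊤≡v)) (tarski v v≢⊥)
      z⊑v : z ⊑ v
      z⊑v = begin
        z                  ≡⟨ trans (cong (_⊓ z) ⊤·v≡⊤) (∧-identityˡ z) ⟨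
        (⊤ · v) ⊓ z        ≤⟨ dedekindʳ ⊤ v z ⟩
        (⊤ ⊓ z · v ᵀ) · v  ≤⟨ ·-monoˡ x⊓y⊑y ⟩
        (z · v ᵀ) · v      ≤⟨ ·-monoˡ (·-monoʳ (ᵀ-mono v⊑z)) ⟩
        (z · z ᵀ) · v      ≤⟨ ·-monoˡ z·zᵀ⊑𝟏 ⟩
        𝟏 · v              ≡⟨ ·-identityˡ v ⟩
        v                  ∎

    point-⊑⇒≡ : ∀ {x y} → point x → point y → x ⊑ y → x ≡ y
    point-⊑⇒≡ ((_ , surj-x) , vec-x) point-y x⊑y with vector-⊑-point vec-x x⊑y point-y
    ... | inj₁ refl = sym (surjective-⊥⇒trivial surj-x _)
    ... | inj₂ x≡y  = x≡y

  module Forest {n} (S↔Fin : S ↔ Fin n) (tarski : Tarski) (p : S) (forest-p : forest p) where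

    infix 4 _≟_
    _≟_ : DecidableEquality S
    _≟_ = inj⇒≟ (↔⇒↣ S↔Fin)

    open Atoms _≟_ tarski

    r l q : S
    r = p ᵀ
    l = p ⊓ 𝟏
    q = (p ⊓ ‾ 𝟏) ᵀ

    Fixed : S → Set c
    Fixed w = w ≡ r · w

    lᵀ≡l : l ᵀ ≡ l
    lᵀ≡l = subidentity-ᵀ x⊓y⊑y

    r≡l⊔q : r ≡ l ⊔ q
    r≡l⊔q = begin
      p ᵀ                          ≡⟨ cong _ᵀ (∧-identityʳ p) ⟨
      (p ⊓ ⊤) ᵀ                    ≡⟨ cong (λ t → (p ⊓ t) ᵀ) (∨-complementʳ 𝟏) ⟨
      (p ⊓ (𝟏 ⊔ ‾ 𝟏)) ᵀ            ≡⟨ cong _ᵀ (∧-distribˡ-∨ p 𝟏 (‾ 𝟏)) ⟩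
      (l ⊔ p ⊓ ‾ 𝟏) ᵀ              ≡⟨ ᵀ-⊔ l (p ⊓ ‾ 𝟏) ⟩
      l ᵀ ⊔ q                      ≡⟨ cong (_⊔ q) lᵀ≡l ⟩
      l ⊔ q                        ∎
      where open ≡-Reasoning

    r⊓𝟏≡l : r ⊓ 𝟏 ≡ l
    r⊓𝟏≡l = trans (cong (r ⊓_) (sym ᵀ-𝟏)) (trans (sym (ᵀ-⊓ p 𝟏)) lᵀ≡l)

    point-r· : ∀ {w} → point w → point (r · w)
    point-r· = mapping-ᵀ·-point (proj₁ forest-p)

    fixed⇒⊑roots : ∀ {w} → injective w → Fixed w → w ⊑ l · ⊤
    fixed⇒⊑roots {w} inj-w w≡r·w = begin
      w             ≡⟨ trans (cong (_⊓ w) (sym w≡r·w)) (∧-idem w) ⟨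
      (r · w) ⊓ w   ≤⟨ injective-meet r inj-w ⟩
      (r ⊓ 𝟏) · w   ≡⟨ cong (_· w) r⊓𝟏≡l ⟩
      l · w         ≤⟨ ·-monoʳ ⊤-greatest ⟩
      l · ⊤         ∎
      where open ⊑-Reasoning

    nonfixed⇒l·≡⊥ : ∀ {w} → point w → ¬ Fixed w → l · w ≡ ⊥
    nonfixed⇒l·≡⊥ {w} point-w ¬fixed with vector-⊑-point l·w-vector l·w⊑w point-w
      where
      open ⊑-Reasoning
      l·w-vector : vector (l · w)
      l·w-vector = trans (·-assoc l w ⊤) (cong (l ·_) (proj₂ point-w))
      l·w⊑w : l · w ⊑ w
      l·w⊑w = ⊑-trans (·-monoˡ x⊓y⊑y) (⊑-reflexive (·-identityˡ w))
    ... | inj₁ l·w≡⊥ = l·w≡⊥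
    ... | inj₂ l·w≡w = ⊥-elim (¬fixed (point-⊑⇒≡ point-w (point-r· point-w) w⊑r·w))
      where
      open ⊑-Reasoning
      w⊑r·w : w ⊑ r · w
      w⊑r·w = begin
        w            ≡⟨ l·w≡w ⟨
        l · w        ≤⟨ ·-monoˡ x⊑x⊔y ⟩
        (l ⊔ q) · w  ≡⟨ cong (_· w) r≡l⊔q ⟨
        r · w        ∎

    nonfixed⇒r·≡q· : ∀ {w} → point w → ¬ Fixed w → r · w ≡ q · w
    nonfixed⇒r·≡q· {w} point-w ¬fixed = begin
      r · w              ≡⟨ cong (_· w) r≡l⊔q ⟩
      (l ⊔ q) · w        ≡⟨ distribʳ w l q ⟩
      l · w ⊔ q · w      ≡⟨ cong (_⊔ q · w) (nonfixed⇒l·≡⊥ point-w ¬fixed) ⟩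
      ⊥ ⊔ q · w          ≡⟨ ⊔-identityˡ (q · w) ⟩
      q · w              ∎
      where open ≡-Reasoning

    nonfixed⇒⊓roots≡⊥ : ∀ {w} → point w → ¬ Fixed w → w ⊓ l · ⊤ ≡ ⊥
    nonfixed⇒⊓roots≡⊥ {w} point-w ¬fixed = ⊑⊥⇒≡⊥ (begin
      w ⊓ l · ⊤           ≡⟨ ∧-comm w (l · ⊤) ⟩
      (l · ⊤) ⊓ w         ≤⟨ dedekind l ⊤ w ⟩
      l · (⊤ ⊓ l ᵀ · w)   ≤⟨ ·-monoʳ x⊓y⊑y ⟩
      l · l ᵀ · w         ≡⟨ cong (λ t → l · t · w) lᵀ≡l ⟩
      l · l · w           ≡⟨ cong (l ·_) (nonfixed⇒l·≡⊥ point-w ¬fixed) ⟩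
      l · ⊥               ≡⟨ zeroʳ l ⟩
      ⊥                   ∎)
      where open ⊑-Reasoning

    orbit : S → ℕ → S
    orbit z m = fold z (r ·_) m

    orbit-point : ∀ {z} → point z → ∀ m → point (orbit z m)
    orbit-point point-z zero    = point-z
    orbit-point point-z (suc m) = point-r· (orbit-point point-z m)

    orbit-suc : ∀ z m → orbit z (suc m) ≡ orbit (r · z) m
    orbit-suc z m = trans (cong (orbit z) (+-comm 1 m)) (fold-+ z (r ·_) m)

    orbit-pow-or-fixed : ∀ {w} → point w → ∀ m → orbit w m ≡ pow q m · w ⊎ Fixed (orbit w m)
    orbit-pow-or-fixed {w} point-w zero = inj₁ (sym (·-identityˡ w))
    orbit-pow-or-fixed {w} point-w (suc m) with orbit-pow-or-fixed point-w m
    ... | inj₂ fixed = inj₂ (cong (r ·_) fixed)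
    ... | inj₁ orbit≡pow with orbit w m ≟ r · orbit w m
    ...   | yes fixed = inj₂ (cong (r ·_) fixed)
    ...   | no ¬fixed = inj₁ (begin
      r · orbit w m         ≡⟨ nonfixed⇒r·≡q· (orbit-point point-w m) ¬fixed ⟩
      q · orbit w m         ≡⟨ cong (q ·_) orbit≡pow ⟩
      q · pow q m · w       ≡⟨ ·-assoc q (pow q m) w ⟨
      pow q (suc m) · w     ∎)
      where open ≡-Reasoning

    periodic⇒fixed : ∀ {w} → point w → ∀ m → w ≡ orbit w (suc m) → Fixed w
    periodic⇒fixed {w} point-w m periodic with orbit-pow-or-fixed point-w (suc m)
    ... | inj₂ fixed     = subst Fixed (sym periodic) fixed
    ... | inj₁ orbit≡pow = subst Fixed (sym w≡⊥) (sym (zeroʳ r))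
      where
      irreflexive-q^m+1 : irreflexive (pow q (suc m))
      irreflexive-q^m+1 = subst irreflexive (sym (pow-ᵀ (p ⊓ ‾ 𝟏) (suc m)))
                                (irreflexive-ᵀ (acyclic⇒irreflexive-pow (proj₂ forest-p) m))
      w≡⊥ : w ≡ ⊥
      w≡⊥ = injective-⊑-irreflexive·⇒≡⊥ (proj₁ (proj₁ point-w)) irreflexive-q^m+1
                                        (⊑-reflexive (trans periodic orbit≡pow))

    orbit-reaches-fixed : ∀ {z} → point z → ∃ λ m → Fixed (orbit z m)
    orbit-reaches-fixed {z} point-z
      with i , j , i<j , orbit-i≡orbit-j ← sequence-repeats S↔Fin (orbit z)
      with k , i+1+k≡j ← m≤n⇒∃[o]m+o≡n i<j
      = i , periodic⇒fixed (orbit-point point-z i) k (begin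
        orbit z i                    ≡⟨ orbit-i≡orbit-j ⟩
        orbit z j                    ≡⟨ cong (orbit z) i+1+k≡j ⟨
        orbit z (suc (i + k))        ≡⟨ cong (λ t → orbit z (suc t)) (+-comm i k) ⟩
        orbit z (suc k + i)          ≡⟨ fold-+ z (r ·_) (suc k) ⟩
        orbit (orbit z i) (suc k)    ∎)
      where open ≡-Reasoning

    loop-terminates : ∀ m z → Fixed (orbit z m) → ∃ (LoopExec p z)
    loop-terminates zero    z fixed = z , stop fixed
    loop-terminates (suc m) z fixed with z ≟ r · z
    ... | yes fixed-z = z , stop fixed-z
    ... | no ¬fixed-z = map₂ (step ¬fixed-z) (loop-terminates m (r · z) (subst Fixed (orbit-suc z m) fixed))

    loopExec-point : ∀ {z y} → point z → LoopExec p z y → point y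
    loopExec-point point-z (stop _)      = point-z
    loopExec-point point-z (step _ exec) = loopExec-point (point-r· point-z) exec

    loopExec-result : ∀ {z y} → point z → LoopExec p z y → y ≡ (r * · z) ⊓ (l · ⊤)
    loopExec-result {z} point-z (stop fixed-z) = sym (begin
      (r * · z) ⊓ l · ⊤   ≡⟨ cong (_⊓ l · ⊤) (*-fixpoint fixed-z) ⟩
      z ⊓ l · ⊤           ≡⟨ ⊑⇒⊓≡ (fixed⇒⊑roots (proj₁ (proj₁ point-z)) fixed-z) ⟩
      z                   ∎)
      where open ≡-Reasoning
    loopExec-result {z} {y} point-z (step ¬fixed-z exec) = sym (begin
      (r * · z) ⊓ l · ⊤                        ≡⟨ cong (_⊓ l · ⊤) (*-unfold-· r z) ⟩
      (z ⊔ r * · (r · z)) ⊓ l · ⊤              ≡⟨ ∧-distribʳ-∨ (l · ⊤) z (r * · (r · z)) ⟩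
      z ⊓ l · ⊤ ⊔ (r * · (r · z)) ⊓ l · ⊤      ≡⟨ cong₂ _⊔_ (nonfixed⇒⊓roots≡⊥ point-z ¬fixed-z)
                                                          (sym (loopExec-result (point-r· point-z) exec)) ⟩
      ⊥ ⊔ y                                    ≡⟨ ⊔-identityˡ y ⟩
      y                                        ∎)
      where open ≡-Reasoning

mainTheorem16 : ∀ {c : Level} (K : KleeneRelationAlgebra c)
                → let open KleeneRelationAlgebra K
                      open KRA K
                  in Finite K → Tarski → (p x : S) → forest p → point x
                     → Σ S (λ y → LoopExec p x y
                                  × (point y × (y ≡ ((p ᵀ) * · x) ⊓ ((p ⊓ 𝟏) · ⊤))))
mainTheorem16 K (_ , S↔Fin) tarski p x forest-p point-x =
  let m , orbit-fixed = orbit-reaches-fixed point-x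
      y , exec        = loop-terminates m x orbit-fixed
  in  y , exec , loopExec-point point-x exec , loopExec-result point-x exec
  where open Properties.Forest K S↔Fin tarski p forest-p
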